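{- Let $G_1,G_2$ be finite simple connected graphs, $G_i$ having $n_i$ vertices and $m_i$ edges. Then the strong product $G_1\boxtimes G_2$ satisfies \begin{align*} F(G_1\boxtimes G_2)={}&n_2F(G_1)+n_1F(G_2)+F(G_1)F(G_2)+6m_2M_1(G_1)+6m_1M_1(G_2)+6m_2F(G_1)\\ &+6m_1F(G_2)+3F(G_2)M_1(G_1)+3F(G_1)M_1(G_2)+6M_1(G_1)M_1(G_2). \end{align*}
   Context: The strong product $G_1\boxtimes G_2$ has vertex set $V(G_1)\times V(G_2)$, with $(u_p,v_r)$ adjacent to $(u_q,v_s)$ iff [$u_p=u_q$ and $v_rv_s\in E(G_2)$] or [$v_r=v_s$ and $u_pu_q\in E(G_1)$] or [$u_pu_q\in E(G_1)$ and $v_rv_s\in E(G_2)$]. For a finite simple graph $G$ with vertex degrees $d_G(v)$: $M_1(G)=\sum_{v} d_G(v)^2$ and $F(G)=\sum_{v} d_G(v)^3$. -}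

module Defs where

open import Data.Bool using (Bool; true; false; _∨_; _∧_)
open import Data.Nat using (ℕ; zero; suc; _+_; _*_; _^_; _<_)
open import Data.Fin using (Fin; remQuot; toℕ) renaming (_≟_ to _≟F_)
open import Data.Fin.Properties using ()
open import Data.Nat.ListAction using (sum)
open import Data.List using (List; []; _∷_; map; allFin; filter; length)
open import Data.Product using (_×_; _,_; proj₁; proj₂; Σ; ∃)
open import Relation.Nullary using (¬_; does)
open import Relation.Binary.PropositionalEquality using (_≡_)

record Graph (n : ℕ) : Set where
  field
    adj     : Fin n → Fin n → Bool
    sym     : ∀ u v → adj u v ≡ adj v u
    irrefl  : ∀ v → adj v v ≡ false
open Graph public

deg : ∀ {n} → Graph n → Fin n → ℕ
deg G v = length (filter (λ w → adj G v w ≡? true) (allFin _))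
  where
    open import Data.Bool.Properties using () renaming (_≟_ to _≡?_)

edges : ∀ {n} → Graph n → ℕ
edges {n} G = sum (map (λ u → length (filter (λ v → adj G u v ≡? true)
                                        (filter (λ v → toℕ u <? toℕ v) (allFin n))))
                       (allFin n))
  where
    open import Data.Bool.Properties using () renaming (_≟_ to _≡?_)
    open import Data.Nat.Properties using (_<?_)

M₁ : ∀ {n} → Graph n → ℕ
M₁ {n} G = sum (map (λ v → deg G v ^ 2) (allFin n))

Fz : ∀ {n} → Graph n → ℕ
Fz {n} G = sum (map (λ v → deg G v ^ 3) (allFin n))

data Walk {n} (G : Graph n) : Fin n → Fin n → Set where
  here : ∀ {v} → Walk G v v
  step : ∀ {u v w} → adj G u v ≡ true → Walk G v w → Walk G u w

Connected : ∀ {n} → Graph n → Set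
Connected G = ∀ u v → Walk G u v

-- strong product on Fin (n₁ * n₂), vertices identified with pairs via remQuot
-- (inverse of Data.Fin.combine).
strongAdj : ∀ {n₁ n₂} → Graph n₁ → Graph n₂ → Fin n₁ × Fin n₂ → Fin n₁ × Fin n₂ → Bool
strongAdj G H (u₁ , v₁) (u₂ , v₂) =
     (does (u₁ ≟F u₂) ∧ adj H v₁ v₂)
  ∨ ((does (v₁ ≟F v₂) ∧ adj G u₁ u₂)
  ∨  (adj G u₁ u₂ ∧ adj H v₁ v₂))

_⊠_ : ∀ {n₁ n₂} → Graph n₁ → Graph n₂ → Graph (n₁ * n₂)
_⊠_ {n₁} {n₂} G H = record
  { adj    = λ x y → strongAdj G H (remQuot n₂ x) (remQuot n₂ y)
  ; sym    = λ x y → symS (remQuot n₂ x) (remQuot n₂ y)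
  ; irrefl = λ x → irrS (remQuot n₂ x)
  }
  where
    open import Relation.Binary.PropositionalEquality using (refl; cong₂; trans)
    open import Relation.Nullary using (yes; no)
    open import Data.Bool.Properties using (∧-zeroʳ)
    sym≟ : ∀ {k} (a b : Fin k) → does (a ≟F b) ≡ does (b ≟F a)
    sym≟ a b with a ≟F b | b ≟F a
    ... | yes _ | yes _ = refl
    ... | no _  | no _  = refl
    ... | yes p | no q  = Data.Empty.⊥-elim (q (Relation.Binary.PropositionalEquality.sym p))
      where import Data.Empty
    ... | no p  | yes q = Data.Empty.⊥-elim (p (Relation.Binary.PropositionalEquality.sym q))
      where import Data.Empty
    symS : ∀ a b → strongAdj G H a b ≡ strongAdj G H b a
    symS (u₁ , v₁) (u₂ , v₂)
      rewrite sym≟ u₁ u₂ | sym≟ v₁ v₂ | Graph.sym G u₁ u₂ | Graph.sym H v₁ v₂ = refl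
    irrS : ∀ a → strongAdj G H a a ≡ false
    irrS (u , v) rewrite irrefl G u | irrefl H v | ∧-zeroʳ (does (u ≟F u))
      | ∧-zeroʳ (does (v ≟F v)) = refl

module Submission where

-- Write d₁, d₂ for the degree functions of G₁, G₂ and pₖ(G) = Σ_v d(v)^k for
-- the k-th power sum of the degrees, so that p₀ = n, p₁ = 2m (handshake
-- lemma), p₂ = M₁ and p₃ = F.  The proof has three ingredients.
--   * Degree formula: in G₁ ⊠ G₂ the neighbours of (u , v) are (u , v') with
--     v' ~ v, (u' , v) with u' ~ u, and (u' , v') with both; these cases are
--     disjoint since the graphs are loopless, so d(u , v) = d₂ + d₁ + d₁d₂.
--   * Cubing: (d₂ + d₁ + d₁d₂)³ is a fixed polynomial Σ c · d₁ⁱ · d₂ʲ with ten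
--     monomials, and summing a monomial over all pairs (u , v) separates into
--     c · pᵢ(G₁) · pⱼ(G₂).
--   * Substituting p₀ … p₃ gives the stated formula by a ring identity.

open import Defs
open import Data.Nat using (ℕ; _+_; _*_)
open import Relation.Binary.PropositionalEquality using (_≡_)

open import Data.Nat using (zero; suc; _^_; _<_)
open import Data.Nat.Properties
  using (+-*-semiring; +-assoc; +-identityʳ; *-identityʳ; <-asym; ≤-antisym; ≮⇒≥; _<?_)
open import Data.Nat.ListAction using () renaming (sum to sumList)
open import Data.Nat.Tactic.RingSolver using (solve-∀)
open import Data.Bool using (Bool; true; false; _∨_; _∧_; if_then_else_)
open import Data.Bool.Properties using () renaming (_≟_ to _≟B_)
open import Data.Fin using (Fin; zero; suc; toℕ; combine; remQuot; _↑ˡ_; _↑ʳ_)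
  renaming (_≟_ to _≟F_)
open import Data.Fin.Properties using (remQuot-combine; toℕ-injective)
open import Data.List using (List; []; _∷_; map; allFin; filter; length; tabulate)
open import Data.List.Properties using (map-tabulate)
open import Data.Product using (_×_; _,_)
open import Relation.Nullary using (Dec; yes; no; does)
open import Relation.Unary using (Pred; Decidable)
open import Relation.Binary.PropositionalEquality using (refl; trans; cong; cong₂)
  renaming (sym to ≡-sym)
open import Data.Empty using (⊥-elim)
open import Algebra.Properties.Semiring.Sum +-*-semiring
  using (sum; sum-syntax; sum-cong-≗; sum-replicate-zero; ∑-distrib-+; ∑-comm;
         *-distribˡ-sum; *-distribʳ-sum)
open Relation.Binary.PropositionalEquality.≡-Reasoning

⟦_⟧ : Bool → ℕ
⟦ b ⟧ = if b then 1 else 0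

∑-one : ∀ n → ∑[ i < n ] 1 ≡ n
∑-one zero    = refl
∑-one (suc n) = cong suc (∑-one n)

∑-++ : ∀ m {k} (f : Fin (m + k) → ℕ) →
  sum f ≡ ∑[ i < m ] f (i ↑ˡ k) + ∑[ j < k ] f (m ↑ʳ j)
∑-++ zero    f = refl
∑-++ (suc m) f = trans (cong (f zero +_) (∑-++ m (λ i → f (suc i))))
                       (≡-sym (+-assoc (f zero) _ _))

∑-combine : ∀ n m (f : Fin (n * m) → ℕ) →
  sum f ≡ ∑[ i < n ] ∑[ j < m ] f (combine i j)
∑-combine zero    m f = refl
∑-combine (suc n) m f = trans (∑-++ m f)
  (cong (∑[ j < m ] f (j ↑ˡ (n * m)) +_) (∑-combine n m (λ x → f (m ↑ʳ x))))

∑-separate : ∀ {n m} (f : Fin n → ℕ) (g : Fin m → ℕ) →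
  ∑[ i < n ] ∑[ j < m ] (f i * g j) ≡ sum f * sum g
∑-separate {n} {m} f g = begin
  ∑[ i < n ] ∑[ j < m ] (f i * g j)  ≡⟨ sum-cong-≗ (λ i → ≡-sym (*-distribˡ-sum (f i) g)) ⟩
  ∑[ i < n ] (f i * sum g)           ≡⟨ ≡-sym (*-distribʳ-sum (sum g) f) ⟩
  sum f * sum g                      ∎

δ : ∀ {n} → Fin n → Fin n → ℕ
δ a b = ⟦ does (a ≟F b) ⟧

∑-δ : ∀ {n} (u : Fin n) (g : Fin n → ℕ) → ∑[ i < n ] (δ u i * g i) ≡ g u
∑-δ {suc n} zero    g = begin
  g zero + 0 + ∑[ i < n ] 0  ≡⟨ cong (g zero + 0 +_) (sum-replicate-zero n) ⟩
  g zero + 0 + 0             ≡⟨ +-identityʳ (g zero + 0) ⟩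
  g zero + 0                 ≡⟨ +-identityʳ (g zero) ⟩
  g zero                     ∎
∑-δ {suc n} (suc u) g = ∑-δ u (λ i → g (suc i))

sumList-allFin : ∀ {n} (g : Fin n → ℕ) → sumList (map g (allFin n)) ≡ sum g
sumList-allFin {n} g = trans (cong sumList (map-tabulate (λ i → i) g)) (sumList-tabulate g)
  where
  sumList-tabulate : ∀ {k} (f : Fin k → ℕ) → sumList (tabulate f) ≡ sum f
  sumList-tabulate {zero}  f = refl
  sumList-tabulate {suc k} f = cong (f zero +_) (sumList-tabulate (λ i → f (suc i)))

sumList-filter : ∀ {A : Set} {p} {P : Pred A p} (P? : Decidable P) (f : A → ℕ) xs →
  sumList (map f (filter P? xs)) ≡ sumList (map (λ x → ⟦ does (P? x) ⟧ * f x) xs)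
sumList-filter P? f []       = refl
sumList-filter P? f (x ∷ xs) with does (P? x)
... | true  = cong₂ _+_ (≡-sym (+-identityʳ (f x))) (sumList-filter P? f xs)
... | false = sumList-filter P? f xs

length-filter : ∀ {A : Set} {p} {P : Pred A p} (P? : Decidable P) xs →
  length (filter P? xs) ≡ sumList (map (λ x → ⟦ does (P? x) ⟧) xs)
length-filter P? []       = refl
length-filter P? (x ∷ xs) with does (P? x)
... | true  = cong suc (length-filter P? xs)
... | false = length-filter P? xs

does-≟-true : ∀ b → does (b ≟B true) ≡ b
does-≟-true true  = refl
does-≟-true false = refl

deg-∑ : ∀ {n} (G : Graph n) v → deg G v ≡ ∑[ w < n ] ⟦ adj G v w ⟧
deg-∑ {n} G v = begin
  deg G v
    ≡⟨ length-filter _ (allFin n) ⟩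
  sumList (map (λ w → ⟦ does (adj G v w ≟B true) ⟧) (allFin n))
    ≡⟨ sumList-allFin {n} _ ⟩
  ∑[ w < n ] ⟦ does (adj G v w ≟B true) ⟧
    ≡⟨ sum-cong-≗ (λ w → cong ⟦_⟧ (does-≟-true (adj G v w))) ⟩
  ∑[ w < n ] ⟦ adj G v w ⟧ ∎

before : ∀ {n} → Fin n → Fin n → ℕ
before u w = ⟦ does (toℕ u <? toℕ w) ⟧

edges-∑ : ∀ {n} (G : Graph n) →
  edges G ≡ ∑[ u < n ] ∑[ w < n ] (before u w * ⟦ adj G u w ⟧)
edges-∑ {n} G = trans (sumList-allFin {n} _) (sum-cong-≗ row)
  where
  row : ∀ u → length (filter (λ w → adj G u w ≟B true) (filter (λ w → toℕ u <? toℕ w) (allFin n)))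
            ≡ ∑[ w < n ] (before u w * ⟦ adj G u w ⟧)
  row u = begin
    length (filter (λ w → adj G u w ≟B true) (filter (λ w → toℕ u <? toℕ w) (allFin n)))
      ≡⟨ length-filter (λ w → adj G u w ≟B true) (filter (λ w → toℕ u <? toℕ w) (allFin n)) ⟩
    sumList (map (λ w → ⟦ does (adj G u w ≟B true) ⟧) (filter (λ w → toℕ u <? toℕ w) (allFin n)))
      ≡⟨ sumList-filter _ _ (allFin n) ⟩
    sumList (map (λ w → before u w * ⟦ does (adj G u w ≟B true) ⟧) (allFin n))
      ≡⟨ sumList-allFin {n} _ ⟩
    ∑[ w < n ] (before u w * ⟦ does (adj G u w ≟B true) ⟧)
      ≡⟨ sum-cong-≗ (λ w → cong (λ b → before u w * ⟦ b ⟧) (does-≟-true (adj G u w))) ⟩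
    ∑[ w < n ] (before u w * ⟦ adj G u w ⟧) ∎

-- Each adjacency is seen exactly once from the earlier endpoint: for u ≠ w
-- exactly one of u before w, w before u holds, and u = w is not an edge.
adj-split : ∀ {n} (G : Graph n) u w →
  ⟦ adj G u w ⟧ ≡ before u w * ⟦ adj G u w ⟧ + before w u * ⟦ adj G w u ⟧
adj-split G u w = by-order (toℕ u <? toℕ w) (toℕ w <? toℕ u)
  where
  by-order : (u<w? : Dec (toℕ u < toℕ w)) (w<u? : Dec (toℕ w < toℕ u)) →
    ⟦ adj G u w ⟧ ≡ ⟦ does u<w? ⟧ * ⟦ adj G u w ⟧ + ⟦ does w<u? ⟧ * ⟦ adj G w u ⟧
  by-order (yes u<w) (yes w<u) = ⊥-elim (<-asym u<w w<u)
  by-order (yes _)   (no _)    = ≡-sym (trans (+-identityʳ _) (+-identityʳ _))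
  by-order (no _)    (yes _)   = trans (cong ⟦_⟧ (Graph.sym G u w)) (≡-sym (+-identityʳ _))
  by-order (no u≮w)  (no w≮u)  =
    trans (cong (λ x → ⟦ adj G u x ⟧) (≡-sym u≡w)) (cong ⟦_⟧ (irrefl G u))
    where
    u≡w : u ≡ w
    u≡w = toℕ-injective (≤-antisym (≮⇒≥ w≮u) (≮⇒≥ u≮w))

handshake : ∀ {n} (G : Graph n) → ∑[ u < n ] deg G u ≡ 2 * edges G
handshake {n} G = begin
  ∑[ u < n ] deg G u
    ≡⟨ sum-cong-≗ (deg-∑ G) ⟩
  ∑[ u < n ] ∑[ w < n ] ⟦ adj G u w ⟧
    ≡⟨ sum-cong-≗ (λ u → trans (sum-cong-≗ (adj-split G u)) (∑-distrib-+ (E u) (λ w → E w u))) ⟩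
  ∑[ u < n ] (∑[ w < n ] E u w + ∑[ w < n ] E w u)
    ≡⟨ ∑-distrib-+ (λ u → ∑[ w < n ] E u w) (λ u → ∑[ w < n ] E w u) ⟩
  ∑[ u < n ] ∑[ w < n ] E u w + ∑[ u < n ] ∑[ w < n ] E w u
    ≡⟨ cong (∑[ u < n ] ∑[ w < n ] E u w +_) (∑-comm (λ u w → E w u)) ⟩
  ∑[ u < n ] ∑[ w < n ] E u w + ∑[ w < n ] ∑[ u < n ] E w u
    ≡⟨ cong (λ e → e + e) (≡-sym (edges-∑ G)) ⟩
  edges G + edges G
    ≡⟨ cong (edges G +_) (≡-sym (+-identityʳ (edges G))) ⟩
  2 * edges G ∎
  where
  E : Fin n → Fin n → ℕ
  E u w = before u w * ⟦ adj G u w ⟧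

-- Iverson bracket of a disjunction of three mutually exclusive cases: the
-- hypotheses say x excludes a and y excludes b, which makes the three
-- disjuncts of the strong-product adjacency pairwise exclusive.
⟦⟧-exclusive-∨ : ∀ x y a b → (x ≡ true → a ≡ false) → (y ≡ true → b ≡ false) →
  ⟦ (x ∧ b) ∨ ((y ∧ a) ∨ (a ∧ b)) ⟧ ≡ ⟦ x ⟧ * ⟦ b ⟧ + (⟦ y ⟧ * ⟦ a ⟧ + ⟦ a ⟧ * ⟦ b ⟧)
⟦⟧-exclusive-∨ true y true b x⇒¬a _ with x⇒¬a refl
... | ()
⟦⟧-exclusive-∨ x true a true _ y⇒¬b with y⇒¬b refl
... | ()
⟦⟧-exclusive-∨ true  true  false false _ _ = refl
⟦⟧-exclusive-∨ true  false false true  _ _ = refl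
⟦⟧-exclusive-∨ true  false false false _ _ = refl
⟦⟧-exclusive-∨ false true  true  false _ _ = refl
⟦⟧-exclusive-∨ false true  false false _ _ = refl
⟦⟧-exclusive-∨ false false true  true  _ _ = refl
⟦⟧-exclusive-∨ false false true  false _ _ = refl
⟦⟧-exclusive-∨ false false false true  _ _ = refl
⟦⟧-exclusive-∨ false false false false _ _ = refl

equal⇒non-adjacent : ∀ {n} (G : Graph n) u w → does (u ≟F w) ≡ true → adj G u w ≡ false
equal⇒non-adjacent G u w u≟w with u ≟F w
equal⇒non-adjacent G u w refl | yes refl = irrefl G u

⊠-adj-indicator : ∀ {n₁ n₂} (G : Graph n₁) (H : Graph n₂) u v u' v' →
  ⟦ strongAdj G H (u , v) (u' , v') ⟧
    ≡ δ u u' * ⟦ adj H v v' ⟧ + (δ v v' * ⟦ adj G u u' ⟧ + ⟦ adj G u u' ⟧ * ⟦ adj H v v' ⟧)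
⊠-adj-indicator G H u v u' v' =
  ⟦⟧-exclusive-∨ (does (u ≟F u')) (does (v ≟F v')) (adj G u u') (adj H v v')
    (equal⇒non-adjacent G u u') (equal⇒non-adjacent H v v')

deg-⊠ : ∀ {n₁ n₂} (G : Graph n₁) (H : Graph n₂) u v →
  deg (G ⊠ H) (combine u v) ≡ deg H v + (deg G u + deg G u * deg H v)
deg-⊠ {n₁} {n₂} G H u v = begin
  deg (G ⊠ H) (combine u v)
    ≡⟨ deg-∑ (G ⊠ H) (combine u v) ⟩
  ∑[ x < n₁ * n₂ ] ⟦ strongAdj G H (remQuot n₂ (combine u v)) (remQuot n₂ x) ⟧
    ≡⟨ ∑-combine n₁ n₂ _ ⟩
  ∑[ u' < n₁ ] ∑[ v' < n₂ ]
    ⟦ strongAdj G H (remQuot n₂ (combine u v)) (remQuot n₂ (combine u' v')) ⟧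
    ≡⟨ sum-cong-≗ (λ u' → sum-cong-≗ (λ v' → cong₂ (λ p q → ⟦ strongAdj G H p q ⟧)
         (remQuot-combine u v) (remQuot-combine u' v'))) ⟩
  ∑[ u' < n₁ ] ∑[ v' < n₂ ] ⟦ strongAdj G H (u , v) (u' , v') ⟧
    ≡⟨ sum-cong-≗ (λ u' → sum-cong-≗ (⊠-adj-indicator G H u v u')) ⟩
  ∑[ u' < n₁ ] ∑[ v' < n₂ ] (δ u u' * B v' + (δ v v' * A u' + A u' * B v'))
    ≡⟨ sum-cong-≗ row ⟩
  ∑[ u' < n₁ ] (δ u u' * dH + (A u' + A u' * dH))
    ≡⟨ ∑-distrib-+ (λ u' → δ u u' * dH) _ ⟩
  ∑[ u' < n₁ ] (δ u u' * dH) + ∑[ u' < n₁ ] (A u' + A u' * dH)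
    ≡⟨ cong₂ _+_ (∑-δ u (λ _ → dH)) (∑-distrib-+ A (λ u' → A u' * dH)) ⟩
  dH + (sum A + ∑[ u' < n₁ ] (A u' * dH))
    ≡⟨ cong (λ s → dH + (sum A + s)) (≡-sym (*-distribʳ-sum dH A)) ⟩
  dH + (sum A + sum A * dH)
    ≡⟨ cong (λ d → dH + (d + d * dH)) (≡-sym (deg-∑ G u)) ⟩
  dH + (deg G u + deg G u * dH) ∎
  where
  A : Fin n₁ → ℕ
  A u' = ⟦ adj G u u' ⟧
  B : Fin n₂ → ℕ
  B v' = ⟦ adj H v v' ⟧
  dH : ℕ
  dH = deg H v
  row : ∀ u' → ∑[ v' < n₂ ] (δ u u' * B v' + (δ v v' * A u' + A u' * B v'))
             ≡ δ u u' * dH + (A u' + A u' * dH)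
  row u' = begin
    ∑[ v' < n₂ ] (δ u u' * B v' + (δ v v' * A u' + A u' * B v'))
      ≡⟨ ∑-distrib-+ (λ v' → δ u u' * B v') _ ⟩
    ∑[ v' < n₂ ] (δ u u' * B v') + ∑[ v' < n₂ ] (δ v v' * A u' + A u' * B v')
      ≡⟨ cong (∑[ v' < n₂ ] (δ u u' * B v') +_)
           (∑-distrib-+ (λ v' → δ v v' * A u') (λ v' → A u' * B v')) ⟩
    ∑[ v' < n₂ ] (δ u u' * B v') + (∑[ v' < n₂ ] (δ v v' * A u') + ∑[ v' < n₂ ] (A u' * B v'))
      ≡⟨ cong₂ (λ p q → p + (∑[ v' < n₂ ] (δ v v' * A u') + q))
           (≡-sym (*-distribˡ-sum (δ u u') B)) (≡-sym (*-distribˡ-sum (A u') B)) ⟩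
    δ u u' * sum B + (∑[ v' < n₂ ] (δ v v' * A u') + A u' * sum B)
      ≡⟨ cong₂ (λ d p → δ u u' * d + (p + A u' * d)) (≡-sym (deg-∑ H v)) (∑-δ v (λ _ → A u')) ⟩
    δ u u' * dH + (A u' + A u' * dH) ∎

Monomial : Set
Monomial = ℕ × ℕ × ℕ

evalPoly : List Monomial → ℕ → ℕ → ℕ
evalPoly []                  a b = 0
evalPoly ((c , i , j) ∷ ts) a b = c * a ^ i * b ^ j + evalPoly ts a b

powerSum : ∀ {n} → (Fin n → ℕ) → ℕ → ℕ
powerSum {n} f k = ∑[ u < n ] (f u ^ k)

evalMoments : List Monomial → (ℕ → ℕ) → (ℕ → ℕ) → ℕ
evalMoments []                  P Q = 0
evalMoments ((c , i , j) ∷ ts) P Q = c * P i * Q j + evalMoments ts P Q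

∑∑-evalPoly : ∀ {n₁ n₂} (f : Fin n₁ → ℕ) (g : Fin n₂ → ℕ) ts →
  ∑[ u < n₁ ] ∑[ v < n₂ ] evalPoly ts (f u) (g v)
    ≡ evalMoments ts (powerSum f) (powerSum g)
∑∑-evalPoly {n₁} {n₂} f g [] =
  trans (sum-cong-≗ {n₁} {λ _ → ∑[ v < n₂ ] 0} (λ _ → sum-replicate-zero n₂))
        (sum-replicate-zero n₁)
∑∑-evalPoly {n₁} {n₂} f g ((c , i , j) ∷ ts) = begin
  ∑[ u < n₁ ] ∑[ v < n₂ ] (m u v + evalPoly ts (f u) (g v))
    ≡⟨ sum-cong-≗ (λ u → ∑-distrib-+ (m u) (λ v → evalPoly ts (f u) (g v))) ⟩
  ∑[ u < n₁ ] (∑[ v < n₂ ] m u v + ∑[ v < n₂ ] evalPoly ts (f u) (g v))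
    ≡⟨ ∑-distrib-+ (λ u → ∑[ v < n₂ ] m u v) _ ⟩
  ∑[ u < n₁ ] ∑[ v < n₂ ] m u v + ∑[ u < n₁ ] ∑[ v < n₂ ] evalPoly ts (f u) (g v)
    ≡⟨ cong₂ _+_ (∑-separate (λ u → c * f u ^ i) (λ v → g v ^ j)) (∑∑-evalPoly f g ts) ⟩
  ∑[ u < n₁ ] (c * f u ^ i) * powerSum g j + evalMoments ts (powerSum f) (powerSum g)
    ≡⟨ cong (λ s → s * powerSum g j + evalMoments ts (powerSum f) (powerSum g)) (≡-sym (*-distribˡ-sum c (λ u → f u ^ i))) ⟩
  c * powerSum f i * powerSum g j + evalMoments ts (powerSum f) (powerSum g) ∎
  where
  m : Fin n₁ → Fin n₂ → ℕ
  m u v = c * f u ^ i * g v ^ j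

cube : List Monomial
cube = (1 , 3 , 0) ∷ (1 , 0 , 3) ∷ (1 , 3 , 3) ∷ (3 , 2 , 1) ∷ (3 , 1 , 2) ∷
       (3 , 3 , 1) ∷ (3 , 1 , 3) ∷ (3 , 2 , 3) ∷ (3 , 3 , 2) ∷ (6 , 2 , 2) ∷ []

cube-expansion : ∀ a b → (b + (a + a * b)) ^ 3 ≡ evalPoly cube a b
cube-expansion = expand
  where
  -- the same statement with powers unfolded, as the ring solver reads it
  expand : ∀ a b → let x = b + (a + a * b) in x * (x * (x * 1)) ≡
    1 * (a * (a * (a * 1))) * 1 + (1 * 1 * (b * (b * (b * 1))) +
    (1 * (a * (a * (a * 1))) * (b * (b * (b * 1))) + (3 * (a * (a * 1)) * (b * 1) +
    (3 * (a * 1) * (b * (b * 1)) + (3 * (a * (a * (a * 1))) * (b * 1) +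
    (3 * (a * 1) * (b * (b * (b * 1))) + (3 * (a * (a * 1)) * (b * (b * (b * 1))) +
    (3 * (a * (a * (a * 1))) * (b * (b * 1)) + (6 * (a * (a * 1)) * (b * (b * 1)) + 0)))))))))
  expand = solve-∀

cube-moments : ∀ n₁ n₂ m₁ m₂ M₁₁ M₁₂ F₁ F₂ (P Q : ℕ → ℕ) →
  P 0 ≡ n₁ → P 1 ≡ 2 * m₁ → P 2 ≡ M₁₁ → P 3 ≡ F₁ →
  Q 0 ≡ n₂ → Q 1 ≡ 2 * m₂ → Q 2 ≡ M₁₂ → Q 3 ≡ F₂ →
  evalMoments cube P Q ≡
    n₂ * F₁ + n₁ * F₂ + F₁ * F₂
    + 6 * m₂ * M₁₁ + 6 * m₁ * M₁₂
    + 6 * m₂ * F₁ + 6 * m₁ * F₂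
    + 3 * F₂ * M₁₁ + 3 * F₁ * M₁₂
    + 6 * M₁₁ * M₁₂
cube-moments n₁ n₂ m₁ m₂ M₁₁ M₁₂ F₁ F₂ P Q p₀ p₁ p₂ p₃ q₀ q₁ q₂ q₃
  rewrite p₀ | p₁ | p₂ | p₃ | q₀ | q₁ | q₂ | q₃ = identity n₁ n₂ m₁ m₂ M₁₁ M₁₂ F₁ F₂
  where
  identity : ∀ n₁ n₂ m₁ m₂ M₁₁ M₁₂ F₁ F₂ →
    1 * F₁ * n₂ + (1 * n₁ * F₂ + (1 * F₁ * F₂ + (3 * M₁₁ * (2 * m₂) +
    (3 * (2 * m₁) * M₁₂ + (3 * F₁ * (2 * m₂) + (3 * (2 * m₁) * F₂ + (3 * M₁₁ * F₂ +
    (3 * F₁ * M₁₂ + (6 * M₁₁ * M₁₂ + 0)))))))))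
      ≡ n₂ * F₁ + n₁ * F₂ + F₁ * F₂
        + 6 * m₂ * M₁₁ + 6 * m₁ * M₁₂
        + 6 * m₂ * F₁ + 6 * m₁ * F₂
        + 3 * F₂ * M₁₁ + 3 * F₁ * M₁₂
        + 6 * M₁₁ * M₁₂
  identity = solve-∀

module DegreePowerSums {n} (G : Graph n) where

  p₀ : powerSum (deg G) 0 ≡ n
  p₀ = ∑-one n

  p₁ : powerSum (deg G) 1 ≡ 2 * edges G
  p₁ = trans (sum-cong-≗ (λ u → *-identityʳ (deg G u))) (handshake G)

  p₂ : powerSum (deg G) 2 ≡ M₁ G
  p₂ = ≡-sym (sumList-allFin {n} _)

  p₃ : powerSum (deg G) 3 ≡ Fz G
  p₃ = ≡-sym (sumList-allFin {n} _)

theorem7 : ∀ {n₁ n₂} (G₁ : Graph n₁) (G₂ : Graph n₂) →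
    Connected G₁ → Connected G₂ →
    Fz (G₁ ⊠ G₂) ≡
      n₂ * Fz G₁ + n₁ * Fz G₂ + Fz G₁ * Fz G₂
      + 6 * edges G₂ * M₁ G₁ + 6 * edges G₁ * M₁ G₂
      + 6 * edges G₂ * Fz G₁ + 6 * edges G₁ * Fz G₂
      + 3 * Fz G₂ * M₁ G₁ + 3 * Fz G₁ * M₁ G₂
      + 6 * M₁ G₁ * M₁ G₂
theorem7 {n₁} {n₂} G₁ G₂ _ _ = begin
  Fz (G₁ ⊠ G₂)
    ≡⟨ sumList-allFin {n₁ * n₂} _ ⟩
  ∑[ x < n₁ * n₂ ] (deg (G₁ ⊠ G₂) x ^ 3)
    ≡⟨ ∑-combine n₁ n₂ _ ⟩
  ∑[ u < n₁ ] ∑[ v < n₂ ] (deg (G₁ ⊠ G₂) (combine u v) ^ 3)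
    ≡⟨ sum-cong-≗ (λ u → sum-cong-≗ (λ v →
         trans (cong (_^ 3) (deg-⊠ G₁ G₂ u v)) (cube-expansion (deg G₁ u) (deg G₂ v)))) ⟩
  ∑[ u < n₁ ] ∑[ v < n₂ ] evalPoly cube (deg G₁ u) (deg G₂ v)
    ≡⟨ ∑∑-evalPoly (deg G₁) (deg G₂) cube ⟩
  evalMoments cube (powerSum (deg G₁)) (powerSum (deg G₂))
    ≡⟨ cube-moments n₁ n₂ (edges G₁) (edges G₂) (M₁ G₁) (M₁ G₂) (Fz G₁) (Fz G₂)
         (powerSum (deg G₁)) (powerSum (deg G₂))
         S₁.p₀ S₁.p₁ S₁.p₂ S₁.p₃ S₂.p₀ S₂.p₁ S₂.p₂ S₂.p₃ ⟩
  _ ∎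
  where
  module S₁ = DegreePowerSums G₁
  module S₂ = DegreePowerSums G₂
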